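{- Let $n\ge 1$. There is an involution $\Upsilon$ on $\mathcal{M}_n\setminus\mathcal{D}_n$ (a map $\Upsilon$ of this set to itself with $\Upsilon\circ\Upsilon=\mathrm{id}$) which is parity reversing: for every path $P\in\mathcal{M}_n\setminus\mathcal{D}_n$, the quantities $1+u(P)+w(P)$ and $1+u(\Upsilon(P))+w(\Upsilon(P))$ have opposite parities, where $u(\cdot)$ denotes the number of up steps and $w(\cdot)$ the number of wavy level steps.
   Context: A $2$-Motzkin path is a lattice path starting and ending on the horizontal axis and never going below it, using up steps $(1,1)$, down steps $(1,-1)$ and level steps $(1,0)$, where each level step is one of two kinds: straight or wavy. Its length is its number of steps. $\mathcal{M}_n$ denotes the set of $2$-Motzkin paths of length $n-1$, and $\mathcal{D}_n\subseteq\mathcal{M}_n$ the subset of those paths having no level steps (i.e. Dyck paths of length $n-1$). The parity of a path $P$ is the parity of $1+u(P)+w(P)$. -}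

module Defs where

open import Data.Nat using (ℕ; zero; suc; _+_; _∸_)
open import Data.List using (List; []; _∷_; length)
open import Data.List.Relation.Unary.Any using (Any)
open import Data.Product using (Σ; _×_)
open import Relation.Binary.PropositionalEquality using (_≡_)

-- Steps of a 2-Motzkin path: up (1,1), down (1,-1), and two kinds of level step.
data Step : Set where
  up down straight wavy : Step

-- `Stays h s`: starting at height h, the step sequence s never goes below
-- the axis and ends at height 0.
data Stays : ℕ → List Step → Set where
  end      : Stays 0 []
  up-step  : ∀ {h s} → Stays (suc h) s → Stays h (up ∷ s)
  down-step : ∀ {h s} → Stays h s → Stays (suc h) (down ∷ s)
  str-step : ∀ {h s} → Stays h s → Stays h (straight ∷ s)
  wav-step : ∀ {h s} → Stays h s → Stays h (wavy ∷ s)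

IsMotzkin : List Step → Set
IsMotzkin s = Stays 0 s

data IsLevel : Step → Set where
  straight-lvl : IsLevel straight
  wavy-lvl     : IsLevel wavy

HasLevel : List Step → Set
HasLevel s = Any IsLevel s

-- 𝓜ₙ ∖ 𝓓ₙ : 2-Motzkin paths of length n - 1 with at least one level step.
MminusD : ℕ → Set
MminusD n = Σ (List Step) (λ s → (length s ≡ n ∸ 1) × IsMotzkin s × HasLevel s)

u : List Step → ℕ
u [] = 0
u (up ∷ s) = suc (u s)
u (_ ∷ s) = u s

w : List Step → ℕ
w [] = 0
w (wavy ∷ s) = suc (w s)
w (_ ∷ s) = w s

{-# OPTIONS --safe #-}
module Submission where

-- Υ changes the kind of the first level step of the path (straight ↔ wavy). This keeps the
-- path a 2-Motzkin path of the same length with a level step, is its own inverse, preserves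
-- u and changes w by exactly one, hence flips the parity of 1 + u + w.

open import Defs
open import Data.Nat using (ℕ; zero; suc; _+_; _≥_; _%_)
open import Data.Nat.Properties using (+-suc; +-comm)
open import Data.Nat.DivMod using ([m+n]%n≡m%n)
open import Data.List using (List; []; _∷_; length)
open import Data.List.Relation.Unary.Any using (here; there)
open import Data.Product using (Σ; _×_; proj₁; _,_)
open import Data.Sum using (_⊎_; inj₁; inj₂)
open import Relation.Binary.PropositionalEquality
  using (_≡_; _≢_; refl; cong; sym; trans; subst; ≢-sym)

[2+m]%2≡m%2 : ∀ m → suc (suc m) % 2 ≡ m % 2
[2+m]%2≡m%2 m = trans (cong (_% 2) (+-comm 2 m)) ([m+n]%n≡m%n m 2)

m%2≢[1+m]%2 : ∀ m → m % 2 ≢ suc m % 2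
m%2≢[1+m]%2 zero          ()
m%2≢[1+m]%2 (suc zero)    ()
m%2≢[1+m]%2 (suc (suc m)) eq =
  m%2≢[1+m]%2 m (trans (sym ([2+m]%2≡m%2 m)) (trans eq ([2+m]%2≡m%2 (suc m))))

[k+m]%2≢[k+n]%2 : ∀ k {m n} → suc m ≡ n ⊎ suc n ≡ m → (k + m) % 2 ≢ (k + n) % 2
[k+m]%2≢[k+n]%2 k {m} {n} (inj₁ m+1≡n) =
  subst (λ j → (k + m) % 2 ≢ j % 2) (trans (sym (+-suc k m)) (cong (k +_) m+1≡n))
    (m%2≢[1+m]%2 (k + m))
[k+m]%2≢[k+n]%2 k (inj₂ n+1≡m) = ≢-sym ([k+m]%2≢[k+n]%2 k (inj₁ n+1≡m))

toggleFirstLevel : List Step → List Step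
toggleFirstLevel []             = []
toggleFirstLevel (straight ∷ s) = wavy ∷ s
toggleFirstLevel (wavy ∷ s)     = straight ∷ s
toggleFirstLevel (up ∷ s)       = up ∷ toggleFirstLevel s
toggleFirstLevel (down ∷ s)     = down ∷ toggleFirstLevel s

toggleFirstLevel-involutive : ∀ s → toggleFirstLevel (toggleFirstLevel s) ≡ s
toggleFirstLevel-involutive []             = refl
toggleFirstLevel-involutive (straight ∷ s) = refl
toggleFirstLevel-involutive (wavy ∷ s)     = refl
toggleFirstLevel-involutive (up ∷ s)       = cong (up ∷_) (toggleFirstLevel-involutive s)
toggleFirstLevel-involutive (down ∷ s)     = cong (down ∷_) (toggleFirstLevel-involutive s)

length-toggleFirstLevel : ∀ s → length (toggleFirstLevel s) ≡ length s
length-toggleFirstLevel []             = refl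
length-toggleFirstLevel (straight ∷ s) = refl
length-toggleFirstLevel (wavy ∷ s)     = refl
length-toggleFirstLevel (up ∷ s)       = cong suc (length-toggleFirstLevel s)
length-toggleFirstLevel (down ∷ s)     = cong suc (length-toggleFirstLevel s)

Stays-toggleFirstLevel : ∀ {h s} → Stays h s → Stays h (toggleFirstLevel s)
Stays-toggleFirstLevel end           = end
Stays-toggleFirstLevel (up-step p)   = up-step (Stays-toggleFirstLevel p)
Stays-toggleFirstLevel (down-step p) = down-step (Stays-toggleFirstLevel p)
Stays-toggleFirstLevel (str-step p)  = wav-step p
Stays-toggleFirstLevel (wav-step p)  = str-step p

HasLevel-toggleFirstLevel : ∀ {s} → HasLevel s → HasLevel (toggleFirstLevel s)
HasLevel-toggleFirstLevel {straight ∷ s} _         = here wavy-lvl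
HasLevel-toggleFirstLevel {wavy ∷ s}     _         = here straight-lvl
HasLevel-toggleFirstLevel {up ∷ s}       (there p) = there (HasLevel-toggleFirstLevel p)
HasLevel-toggleFirstLevel {down ∷ s}     (there p) = there (HasLevel-toggleFirstLevel p)

u-toggleFirstLevel : ∀ s → u (toggleFirstLevel s) ≡ u s
u-toggleFirstLevel []             = refl
u-toggleFirstLevel (straight ∷ s) = refl
u-toggleFirstLevel (wavy ∷ s)     = refl
u-toggleFirstLevel (up ∷ s)       = cong suc (u-toggleFirstLevel s)
u-toggleFirstLevel (down ∷ s)     = u-toggleFirstLevel s

w-toggleFirstLevel : ∀ {s} → HasLevel s →
  suc (w s) ≡ w (toggleFirstLevel s) ⊎ suc (w (toggleFirstLevel s)) ≡ w s
w-toggleFirstLevel {straight ∷ s} _         = inj₁ refl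
w-toggleFirstLevel {wavy ∷ s}     _         = inj₂ refl
w-toggleFirstLevel {up ∷ s}       (there p) = w-toggleFirstLevel p
w-toggleFirstLevel {down ∷ s}     (there p) = w-toggleFirstLevel p

toggleFirstLevelₘ : ∀ {n} → MminusD n → MminusD n
toggleFirstLevelₘ (s , len , motzkin , level) =
  toggleFirstLevel s , trans (length-toggleFirstLevel s) len ,
  Stays-toggleFirstLevel motzkin , HasLevel-toggleFirstLevel level

toggleFirstLevelₘ-flips-parity : ∀ {n} (P : MminusD n) →
  let s = proj₁ P ; t = proj₁ (toggleFirstLevelₘ {n} P) in
  (1 + u s + w s) % 2 ≢ (1 + u t + w t) % 2
toggleFirstLevelₘ-flips-parity (s , _ , _ , level)
  rewrite u-toggleFirstLevel s =
    [k+m]%2≢[k+n]%2 (1 + u s) (w-toggleFirstLevel level)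

theorem4 : (n : ℕ) → n ≥ 1 →
    Σ (MminusD n → MminusD n) λ Υ →
      ((P : MminusD n) → proj₁ (Υ (Υ P)) ≡ proj₁ P) ×
      ((P : MminusD n) →
        (1 + u (proj₁ P) + w (proj₁ P)) % 2
          ≢ (1 + u (proj₁ (Υ P)) + w (proj₁ (Υ P))) % 2)
theorem4 n _ =
  toggleFirstLevelₘ {n} ,
  (λ P → toggleFirstLevel-involutive (proj₁ P)) ,
  toggleFirstLevelₘ-flips-parity {n}
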